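{- Let $P$ be a lattice with CLFPP and let $Q$ be a lattice which is either an order retract of $P$ or a lattice quotient of $P$. Then $Q$ has CLFPP.
   Context: $Q$ is an order retract of $P$ if there are order preserving maps $s:Q\to P$, $r:P\to Q$ with $r\circ s=\mathrm{id}_Q$; $Q$ is a lattice quotient of $P$ if it is the image of a surjective lattice homomorphism $P\to Q$. For a lattice $T$, $\mathcal{C}_L(T)$ is the set of nonempty convex sublattices of $T$ ordered by the bi-dominating order ($X\le Y$ iff every element of $X$ is below some element of $Y$ and every element of $Y$ is above some element of $X$); $T$ has CLFPP if every order preserving map $f:T\to\mathcal{C}_L(T)$ has some $x$ with $x\in f(x)$. -}

module Defs where

open import Level using (Level; _⊔_; suc)
open import Data.Product using (Σ; ∃; _×_; _,_)
open import Data.Sum using (_⊎_)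
open import Relation.Unary using (Pred; _∈_)
open import Relation.Binary.Lattice.Bundles using (Lattice)

private
  variable
    c ℓ₁ ℓ₂ : Level

module _ (T : Lattice c ℓ₁ ℓ₂) where
  open Lattice T

  record ConvexSublattice : Set (suc (c ⊔ ℓ₁ ⊔ ℓ₂)) where
    field
      mem       : Pred Carrier (c ⊔ ℓ₁ ⊔ ℓ₂)
      respects  : ∀ {x y} → x ≈ y → x ∈ mem → y ∈ mem
      nonempty  : ∃ λ x → x ∈ mem
      ∨-closed  : ∀ {x y} → x ∈ mem → y ∈ mem → (x ∨ y) ∈ mem
      ∧-closed  : ∀ {x y} → x ∈ mem → y ∈ mem → (x ∧ y) ∈ mem
      convex    : ∀ {x y z} → x ∈ mem → z ∈ mem → x ≤ y → y ≤ z → y ∈ mem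
  open ConvexSublattice public

  _⊑_ : ConvexSublattice → ConvexSublattice → Set (c ⊔ ℓ₁ ⊔ ℓ₂)
  X ⊑ Y = (∀ x → x ∈ mem X → ∃ λ y → y ∈ mem Y × x ≤ y)
        × (∀ y → y ∈ mem Y → ∃ λ x → x ∈ mem X × x ≤ y)

  Monotone-CL : (Carrier → ConvexSublattice) → Set (c ⊔ ℓ₁ ⊔ ℓ₂)
  Monotone-CL f = ∀ {x y} → x ≤ y → f x ⊑ f y

  CLFPP : Set (suc (c ⊔ ℓ₁ ⊔ ℓ₂))
  CLFPP = (f : Carrier → ConvexSublattice) → Monotone-CL f → ∃ λ x → x ∈ mem (f x)

module _ {c₁ ℓ₁₁ ℓ₁₂ c₂ ℓ₂₁ ℓ₂₂} (P : Lattice c₁ ℓ₁₁ ℓ₁₂) (Q : Lattice c₂ ℓ₂₁ ℓ₂₂) where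
  private
    module P = Lattice P
    module Q = Lattice Q

  OrderPreserving : (P.Carrier → Q.Carrier) → Set (c₁ ⊔ ℓ₁₂ ⊔ ℓ₂₂)
  OrderPreserving h = ∀ {x y} → x P.≤ y → h x Q.≤ h y

  record IsLatticeHom (h : P.Carrier → Q.Carrier) : Set (c₁ ⊔ ℓ₁₁ ⊔ ℓ₂₁) where
    field
      cong   : ∀ {x y} → x P.≈ y → h x Q.≈ h y
      pres-∨ : ∀ x y → h (x P.∨ y) Q.≈ (h x Q.∨ h y)
      pres-∧ : ∀ x y → h (x P.∧ y) Q.≈ (h x Q.∧ h y)

  Surjective : (P.Carrier → Q.Carrier) → Set (c₁ ⊔ c₂ ⊔ ℓ₂₁)
  Surjective h = ∀ q → ∃ λ p → h p Q.≈ q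

IsOrderRetract : ∀ {c₁ ℓ₁₁ ℓ₁₂ c₂ ℓ₂₁ ℓ₂₂} (Q : Lattice c₂ ℓ₂₁ ℓ₂₂) (P : Lattice c₁ ℓ₁₁ ℓ₁₂) → Set _
IsOrderRetract Q P =
  Σ (Lattice.Carrier Q → Lattice.Carrier P) λ s →
  Σ (Lattice.Carrier P → Lattice.Carrier Q) λ r →
    OrderPreserving Q P s × OrderPreserving P Q r ×
    (∀ q → Lattice._≈_ Q (r (s q)) q)

IsLatticeQuotient : ∀ {c₁ ℓ₁₁ ℓ₁₂ c₂ ℓ₂₁ ℓ₂₂} (Q : Lattice c₂ ℓ₂₁ ℓ₂₂) (P : Lattice c₁ ℓ₁₁ ℓ₁₂) → Set _
IsLatticeQuotient Q P =
  Σ (Lattice.Carrier P → Lattice.Carrier Q) λ h → IsLatticeHom P Q h × Surjective P Q h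

-- A fixed point property transfers from P to Q along an order-preserving
-- u : P → Q as soon as every convex sublattice X of Q can be pulled back
-- monotonically to a convex sublattice Φ X of P with u (Φ X) ⊆ X: a fixed
-- point p ∈ Φ (f (u p)) of Φ ∘ f ∘ u gives u p ∈ f (u p).  For a retract
-- (s , r) take Φ X to be the convex hull of s X, which r maps back into X by
-- convexity; for a surjective lattice homomorphism h take Φ X = h⁻¹ X.
module Submission where

open import Defs
open import Level using (Level)
open import Data.Sum using (_⊎_; inj₁; inj₂)
open import Data.Product using (∃; _×_; _,_)
open import Relation.Binary.Lattice.Bundles using (Lattice)
open import Relation.Unary using (_∈_)
import Relation.Binary.Lattice.Properties.JoinSemilattice as JoinSemilatticeProperties

private
  variable
    c ℓ₁ ℓ₂ : Level

module _ (P Q : Lattice c ℓ₁ ℓ₂) where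
  private
    module P = Lattice P
    module Q = Lattice Q

  CLFPP-transfer : CLFPP P →
    (u : P.Carrier → Q.Carrier) → OrderPreserving P Q u →
    (Φ : ConvexSublattice Q → ConvexSublattice P) →
    (∀ {X Y} → _⊑_ Q X Y → _⊑_ P (Φ X) (Φ Y)) →
    (∀ X {p} → p ∈ mem (Φ X) → u p ∈ mem X) →
    CLFPP Q
  CLFPP-transfer clfpp u u-mono Φ Φ-mono u-Φ⊆ f f-mono =
    let (p , p∈Φfup) = clfpp (λ p → Φ (f (u p))) (λ le → Φ-mono (f-mono (u-mono le)))
    in u p , u-Φ⊆ (f (u p)) p∈Φfup

module Retract (P Q : Lattice c ℓ₁ ℓ₂)
  (s : Lattice.Carrier Q → Lattice.Carrier P) (s-mono : OrderPreserving Q P s) where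
  private
    module P = Lattice P
    module Q = Lattice Q

  hullOfImage : ConvexSublattice Q → ConvexSublattice P
  hullOfImage X = record
    { mem = λ y → (∃ λ a → a ∈ mem X × s a P.≤ y) × (∃ λ b → b ∈ mem X × y P.≤ s b)
    ; respects = λ { e ((a , a∈ , a≤) , (b , b∈ , ≤b)) →
        (a , a∈ , P.trans a≤ (P.reflexive e)) , (b , b∈ , P.trans (P.reflexive (P.Eq.sym e)) ≤b) }
    ; nonempty = let (a , a∈) = nonempty X in s a , (a , a∈ , P.refl) , (a , a∈ , P.refl)
    ; ∨-closed = λ { ((a , a∈ , a≤) , (b₁ , b₁∈ , ≤b₁)) (_ , (b₂ , b₂∈ , ≤b₂)) →
        (a , a∈ , P.trans a≤ (P.x≤x∨y _ _)) ,
        (b₁ Q.∨ b₂ , ∨-closed X b₁∈ b₂∈ ,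
          P.∨-least (P.trans ≤b₁ (s-mono (Q.x≤x∨y _ _))) (P.trans ≤b₂ (s-mono (Q.y≤x∨y _ _)))) }
    ; ∧-closed = λ { ((a₁ , a₁∈ , a₁≤) , (b , b∈ , ≤b)) ((a₂ , a₂∈ , a₂≤) , _) →
        (a₁ Q.∧ a₂ , ∧-closed X a₁∈ a₂∈ ,
          P.∧-greatest (P.trans (s-mono (Q.x∧y≤x _ _)) a₁≤) (P.trans (s-mono (Q.x∧y≤y _ _)) a₂≤)) ,
        (b , b∈ , P.trans (P.x∧y≤x _ _) ≤b) }
    ; convex = λ { ((a , a∈ , a≤) , _) (_ , (b , b∈ , ≤b)) x≤y y≤z →
        (a , a∈ , P.trans a≤ x≤y) , (b , b∈ , P.trans y≤z ≤b) }
    }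

  image⊆hullOfImage : ∀ X {a} → a ∈ mem X → s a ∈ mem (hullOfImage X)
  image⊆hullOfImage X {a} a∈ = (a , a∈ , P.refl) , (a , a∈ , P.refl)

  hullOfImage-mono : ∀ {X Y} → _⊑_ Q X Y → _⊑_ P (hullOfImage X) (hullOfImage Y)
  hullOfImage-mono {X} {Y} (up , down) =
    (λ { _ (_ , (b , b∈ , ≤b)) →
      let (b′ , b′∈ , b≤b′) = up b b∈ in
      s b′ , image⊆hullOfImage Y b′∈ , P.trans ≤b (s-mono b≤b′) }) ,
    (λ { _ ((a′ , a′∈ , a′≤) , _) →
      let (a , a∈ , a≤a′) = down a′ a′∈ in
      s a , image⊆hullOfImage X a∈ , P.trans (s-mono a≤a′) a′≤ })

  retraction-hullOfImage⊆ : (r : Lattice.Carrier P → Lattice.Carrier Q) → OrderPreserving P Q r →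
    (∀ q → r (s q) Q.≈ q) → ∀ X {p} → p ∈ mem (hullOfImage X) → r p ∈ mem X
  retraction-hullOfImage⊆ r r-mono r∘s≈id X ((a , a∈ , a≤) , (b , b∈ , ≤b)) =
    convex X a∈ b∈ (Q.trans (Q.reflexive (Q.Eq.sym (r∘s≈id a))) (r-mono a≤))
                   (Q.trans (r-mono ≤b) (Q.reflexive (r∘s≈id b)))

module Quotient (P Q : Lattice c ℓ₁ ℓ₂)
  (h : Lattice.Carrier P → Lattice.Carrier Q) (h-hom : IsLatticeHom P Q h) (h-onto : Surjective P Q h) where
  private
    module P = Lattice P
    module Q = Lattice Q
    open IsLatticeHom h-hom
    module PJ = JoinSemilatticeProperties P.joinSemilattice
    module QJ = JoinSemilatticeProperties Q.joinSemilattice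

  latticeHom-mono : OrderPreserving P Q h
  latticeHom-mono {x} {y} x≤y = Q.trans (Q.x≤x∨y (h x) (h y))
    (Q.reflexive (Q.Eq.trans (Q.Eq.sym (pres-∨ x y)) (cong (PJ.x≤y⇒x∨y≈y x≤y))))

  lift-above : ∀ {x q} → h x Q.≤ q → ∃ λ z → x P.≤ z × h z Q.≈ q
  lift-above {x} {q} hx≤q =
    let (p , hp≈q) = h-onto q in
    x P.∨ p , P.x≤x∨y x p ,
    Q.Eq.trans (pres-∨ x p)
      (Q.Eq.trans (QJ.x≤y⇒x∨y≈y (Q.trans hx≤q (Q.reflexive (Q.Eq.sym hp≈q)))) hp≈q)

  lift-below : ∀ {x q} → q Q.≤ h x → ∃ λ z → z P.≤ x × h z Q.≈ q
  lift-below {x} {q} q≤hx =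
    let (p , hp≈q) = h-onto q in
    x P.∧ p , P.x∧y≤x x p ,
    Q.Eq.trans (pres-∧ x p)
      (Q.antisym (Q.trans (Q.x∧y≤y _ _) (Q.reflexive hp≈q))
                 (Q.∧-greatest q≤hx (Q.reflexive (Q.Eq.sym hp≈q))))

  preimage : ConvexSublattice Q → ConvexSublattice P
  preimage X = record
    { mem = λ y → h y ∈ mem X
    ; respects = λ x≈y → respects X (cong x≈y)
    ; nonempty = let (q , q∈) = nonempty X ; (p , hp≈q) = h-onto q in
        p , respects X (Q.Eq.sym hp≈q) q∈
    ; ∨-closed = λ x∈ y∈ → respects X (Q.Eq.sym (pres-∨ _ _)) (∨-closed X x∈ y∈)
    ; ∧-closed = λ x∈ y∈ → respects X (Q.Eq.sym (pres-∧ _ _)) (∧-closed X x∈ y∈)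
    ; convex = λ x∈ z∈ x≤y y≤z → convex X x∈ z∈ (latticeHom-mono x≤y) (latticeHom-mono y≤z)
    }

  preimage-mono : ∀ {X Y} → _⊑_ Q X Y → _⊑_ P (preimage X) (preimage Y)
  preimage-mono {X} {Y} (up , down) =
    (λ x x∈ →
      let (q , q∈ , hx≤q) = up (h x) x∈ ; (z , x≤z , hz≈q) = lift-above hx≤q in
      z , respects Y (Q.Eq.sym hz≈q) q∈ , x≤z) ,
    (λ y y∈ →
      let (q , q∈ , q≤hy) = down (h y) y∈ ; (z , z≤y , hz≈q) = lift-below q≤hy in
      z , respects X (Q.Eq.sym hz≈q) q∈ , z≤y)

mainTheorem9 : ∀ {c ℓ₁ ℓ₂ : Level} (P Q : Lattice c ℓ₁ ℓ₂) →
    CLFPP P → (IsOrderRetract Q P ⊎ IsLatticeQuotient Q P) → CLFPP Q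
mainTheorem9 P Q clfpp (inj₁ (s , r , s-mono , r-mono , r∘s≈id)) =
  CLFPP-transfer P Q clfpp r r-mono hullOfImage (λ {X} {Y} → hullOfImage-mono {X} {Y})
    (retraction-hullOfImage⊆ r r-mono r∘s≈id)
  where open Retract P Q s s-mono
mainTheorem9 P Q clfpp (inj₂ (h , h-hom , h-onto)) =
  CLFPP-transfer P Q clfpp h latticeHom-mono preimage (λ {X} {Y} → preimage-mono {X} {Y}) (λ _ h∈ → h∈)
  where open Quotient P Q h h-hom h-onto
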